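{- Fix a positive integer $d$. Consider all graphs $G$ of the following type: there are an integer $D\ge 1$ and an integer $t>\frac12 D(D+1)$ and simple $D$-regular graphs $H_1,\dots,H_t$, each with chromatic index $D+1$, such that $G$ is the complement of the disjoint union of $H_1,\dots,H_t$, and $|V(G)|-D=d$. Then, up to isomorphism, there are only finitely many such graphs $G$.
   Context: The chromatic index of a graph is the minimum number of colors in a proper edge coloring. -}

module Defs where

open import Data.Nat using (ℕ; zero; suc; _+_; _<_)
open import Data.Fin using (Fin; zero; suc; splitAt)
open import Data.Fin.Properties using (_≟_)
open import Data.Bool using (Bool; true; false; not; _∧_; if_then_else_)
open import Data.Sum using (_⊎_; inj₁; inj₂)
open import Data.Product using (Σ; _×_; _,_)
open import Data.List using (List)
open import Data.List.Membership.Propositional using (_∈_)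
open import Relation.Nullary using (¬_)
open import Relation.Nullary.Decidable using (⌊_⌋)
open import Relation.Binary.PropositionalEquality using (_≡_; _≢_)
open import Function.Bundles using (_↔_; Inverse)

record Graph : Set where
  constructor mkGraph
  field
    size : ℕ
    adj  : Fin size → Fin size → Bool
open Graph public

IsSimple : Graph → Set
IsSimple G = (∀ u v → adj G u v ≡ adj G v u) × (∀ v → adj G v v ≡ false)

count : ∀ {n} → (Fin n → Bool) → ℕ
count {zero}  f = 0
count {suc n} f = (if f zero then 1 else 0) + count (λ i → f (suc i))

degree : (G : Graph) → Fin (size G) → ℕ
degree G u = count (adj G u)

IsRegular : ℕ → Graph → Set
IsRegular D G = ∀ u → degree G u ≡ D

EdgeColorable : Graph → ℕ → Set
EdgeColorable G k =
  Σ (Fin (size G) → Fin (size G) → Fin k) λ c →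
    (∀ u v → adj G u v ≡ true → c u v ≡ c v u) ×
    (∀ u v w → adj G u v ≡ true → adj G u w ≡ true → v ≢ w → c u v ≢ c u w)

ChromaticIndex : Graph → ℕ → Set
ChromaticIndex G k = EdgeColorable G k × (∀ j → j < k → ¬ EdgeColorable G j)

emptyGraph : Graph
emptyGraph = mkGraph 0 (λ ())

_⊕_ : Graph → Graph → Graph
G ⊕ H = mkGraph (size G + size H) adj′
  where
  adj′ : Fin (size G + size H) → Fin (size G + size H) → Bool
  adj′ u v with splitAt (size G) u | splitAt (size G) v
  ... | inj₁ a | inj₁ b = adj G a b
  ... | inj₂ a | inj₂ b = adj H a b
  ... | _      | _      = false

⨆ : ∀ {t} → (Fin t → Graph) → Graph
⨆ {zero}  H = emptyGraph
⨆ {suc t} H = H zero ⊕ ⨆ (λ i → H (suc i))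

complement : Graph → Graph
complement G = mkGraph (size G) (λ u v → not (adj G u v) ∧ not ⌊ u ≟ v ⌋)

_≅_ : Graph → Graph → Set
G ≅ H = Σ (Fin (size G) ↔ Fin (size H)) λ f →
          ∀ u v → adj G u v ≡ adj H (Inverse.to f u) (Inverse.to f v)

module Submission where

-- A graph G of the kind described has at most 2d vertices, and there are only
-- finitely many graphs on at most N vertices; so the list of all adjacency
-- relations on Fin n, n ≤ 2d, already contains (up to the identity
-- isomorphism) every such G.
-- For the theorem, D(D + 1) < 2t with D ≥ 1 forces t ≥ 2, hence
-- D + d = |V(G)| ≥ 2(D + 1), so D ≤ d and |V(G)| ≤ 2d.

open import Defs
open import Data.Nat using (ℕ; zero; suc; _+_; _*_; _<_; _≤_; z≤n; s≤s)
open import Data.Nat.Properties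
open import Data.Fin using (Fin; zero; suc)
open import Data.Bool using (Bool; true; false)
open import Data.Product using (Σ; _×_; _,_)
open import Data.List using (List; []; _∷_; map; concatMap; upTo)
open import Data.List.Membership.Propositional using (_∈_)
open import Data.List.Membership.Propositional.Properties using (∈-map⁺; ∈-concatMap⁺; ∈-upTo⁺)
open import Data.List.Relation.Unary.Any as Any using (here; there)
open import Relation.Binary.PropositionalEquality using (_≡_; refl; sym; cong)
open import Function.Properties.Inverse using (↔-refl)

∈-concatMap-map : ∀ {A C : Set} {B : A → Set} (f : ∀ x → List (B x)) (g : ∀ x → B x → C)
  {xs : List A} {x : A} {y : B x} →
  x ∈ xs → y ∈ f x → g x y ∈ concatMap (λ x → map (g x) (f x)) xs
∈-concatMap-map f g {x = x} x∈xs y∈fx =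
  ∈-concatMap⁺ _ (Any.map (λ { refl → ∈-map⁺ (g x) y∈fx }) x∈xs)

cons : ∀ {B : Set} {n} → B → (Fin n → B) → Fin (suc n) → B
cons b g zero    = b
cons b g (suc i) = g i

functions : ∀ {B : Set} → List B → (n : ℕ) → List (Fin n → B)
functions xs zero    = (λ ()) ∷ []
functions xs (suc n) = concatMap (λ b → map (cons b) (functions xs n)) xs

functions-cover : ∀ {B : Set} (R : B → B → Set) (xs : List B) →
  (∀ b → Σ B λ b′ → b′ ∈ xs × R b b′) →
  ∀ n (f : Fin n → B) → Σ (Fin n → B) λ g → g ∈ functions xs n × (∀ i → R (f i) (g i))
functions-cover R xs cover zero f = (λ ()) , here refl , λ ()
functions-cover R xs cover (suc n) f
  with cover (f zero) | functions-cover R xs cover n (λ i → f (suc i))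
... | b′ , b′∈xs , r₀ | g , g∈ , rs =
  cons b′ g , ∈-concatMap-map (λ _ → functions xs n) cons b′∈xs g∈ , related
  where
  related : ∀ i → R (f i) (cons b′ g i)
  related zero    = r₀
  related (suc i) = rs i

bools : List Bool
bools = true ∷ false ∷ []

bools-complete : ∀ b → Σ Bool λ b′ → b′ ∈ bools × b ≡ b′
bools-complete true  = true  , here refl , refl
bools-complete false = false , there (here refl) , refl

relations : (n : ℕ) → List (Fin n → Fin n → Bool)
relations n = functions (functions bools n) n

relations-cover : ∀ n (a : Fin n → Fin n → Bool) →
  Σ (Fin n → Fin n → Bool) λ b → b ∈ relations n × (∀ u v → a u v ≡ b u v)
relations-cover n =
  functions-cover (λ r s → ∀ v → r v ≡ s v) (functions bools n)
    (functions-cover _≡_ bools bools-complete n) n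

graphsUpTo : ℕ → List Graph
graphsUpTo N = concatMap (λ n → map (mkGraph n) (relations n)) (upTo (suc N))

graphsUpTo-complete : ∀ N (G : Graph) → size G ≤ N →
  Σ Graph λ G′ → G′ ∈ graphsUpTo N × (G ≅ G′)
graphsUpTo-complete N (mkGraph n a) n≤N with relations-cover n a
... | b , b∈ , a≗b =
  mkGraph n b , ∈-concatMap-map relations mkGraph (∈-upTo⁺ (s≤s n≤N)) b∈ , ↔-refl , a≗b

count≤ : ∀ {n} (f : Fin n → Bool) → count f ≤ n
count≤ {zero}  f = z≤n
count≤ {suc n} f with f zero
... | true  = s≤s (count≤ (λ i → f (suc i)))
... | false = m≤n⇒m≤1+n (count≤ (λ i → f (suc i)))

-- If vertex zero of a graph on n + 1 vertices has no loop, its degree is at most n;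
-- one vertex suffices to bound the common degree of a regular graph.
degree-zero≤ : ∀ {n} (a : Fin (suc n) → Fin (suc n) → Bool) →
  a zero zero ≡ false → count (a zero) ≤ n
degree-zero≤ a loop rewrite loop = count≤ (λ i → a zero (suc i))

regular-size : ∀ D (G : Graph) → 0 < size G → IsSimple G → IsRegular D G → D < size G
regular-size D (mkGraph (suc n) a) _ (_ , loopless) regular
  rewrite sym (regular zero) = s≤s (degree-zero≤ a (loopless zero))

empty-colourable : ∀ (a : Fin 0 → Fin 0 → Bool) → EdgeColorable (mkGraph 0 a) 0
empty-colourable a = (λ ()) , (λ ()) , (λ ())

chromaticIndex-nonempty : ∀ G k → ChromaticIndex G (suc k) → 0 < size G
chromaticIndex-nonempty (mkGraph zero a) k (_ , minimal) with minimal 0 (s≤s z≤n) (empty-colourable a)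
... | ()
chromaticIndex-nonempty (mkGraph (suc n) a) k _ = s≤s z≤n

class-two-size : ∀ D G → IsSimple G × IsRegular D G × ChromaticIndex G (suc D) → suc D ≤ size G
class-two-size D G (simple , regular , index) =
  regular-size D G (chromaticIndex-nonempty G D index) simple regular

⨆-size : ∀ m {t} (H : Fin t → Graph) → (∀ i → m ≤ size (H i)) → t * m ≤ size (⨆ H)
⨆-size m {zero}  H bound = z≤n
⨆-size m {suc t} H bound = +-mono-≤ (bound zero) (⨆-size m (λ i → H (suc i)) (λ i → bound (suc i)))

two-summands : ∀ D t → 1 ≤ D → D * (D + 1) < 2 * t → 2 ≤ t
two-summands D t D≥1 lt = *-cancelˡ-< 2 1 t (≤-<-trans two≤ lt)
  where
  two≤ : 2 ≤ D * (D + 1)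
  two≤ = *-mono-≤ D≥1 (+-monoˡ-≤ 1 D≥1)

size-bound : ∀ D d → 2 * suc D ≤ D + d → D + d ≤ d + d
size-bound D d two-blocks = +-monoˡ-≤ d D≤d
  where
  open ≤-Reasoning
  D≤d : D ≤ d
  D≤d = +-cancelˡ-≤ D D d (begin
    D + D              ≤⟨ +-mono-≤ (n≤1+n D) (n≤1+n D) ⟩
    suc D + suc D      ≡⟨ cong (suc D +_) (sym (+-identityʳ (suc D))) ⟩
    2 * suc D          ≤⟨ two-blocks ⟩
    D + d              ∎)

lemma5p2 : (d : ℕ) → 1 ≤ d →
    Σ (List Graph) λ L →
    (D t : ℕ) → 1 ≤ D → D * (D + 1) < 2 * t →
    (H : Fin t → Graph) →
    (∀ i → IsSimple (H i) × IsRegular D (H i) × ChromaticIndex (H i) (suc D)) →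
    size (complement (⨆ H)) ≡ D + d →
    Σ Graph λ G → G ∈ L × (complement (⨆ H) ≅ G)
lemma5p2 d _ = graphsUpTo (d + d) , bounded
  where
  bounded : (D t : ℕ) → 1 ≤ D → D * (D + 1) < 2 * t →
    (H : Fin t → Graph) →
    (∀ i → IsSimple (H i) × IsRegular D (H i) × ChromaticIndex (H i) (suc D)) →
    size (complement (⨆ H)) ≡ D + d →
    Σ Graph λ G → G ∈ graphsUpTo (d + d) × (complement (⨆ H) ≅ G)
  bounded D t D≥1 lt H classTwo size≡ =
    graphsUpTo-complete (d + d) (complement (⨆ H))
      (≤-trans (≤-reflexive size≡) (size-bound D d two-blocks))
    where
    two-blocks : 2 * suc D ≤ D + d
    two-blocks = begin
      2 * suc D            ≤⟨ *-monoˡ-≤ (suc D) (two-summands D t D≥1 lt) ⟩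
      t * suc D            ≤⟨ ⨆-size (suc D) H (λ i → class-two-size D (H i) (classTwo i)) ⟩
      size (⨆ H)           ≡⟨ size≡ ⟩   -- complementing keeps the vertex set
      D + d                ∎
      where open ≤-Reasoning
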